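{- Let $n\geq 5$ be an integer. Then $\xi^{ac}\!\left(TB_{n,\lceil (n-1)/3\rceil}\right)>\xi^{ac}(S_n)$ if and only if $n\geq 16$.
   Context: $S_n$ is the star on $n$ vertices. A tree of diameter $4$ has a unique central vertex (the vertex of minimum eccentricity $\varepsilon(u)=\max_v d(u,v)$). A tree is degree balanced if its diameter is $4$ and all neighbors of its central vertex have degrees differing pairwise by at most one; $TB_{n,k}$ denotes the (unique up to isomorphism) degree balanced tree on $n$ vertices whose central vertex has degree $k$. $M(u)$ is the product of the degrees of all neighbors of $u$, and $\xi^{ac}(G)=\sum_{u\in V(G)}\frac{M(u)}{\varepsilon(u)}$. -}

module Defs where

open import Data.Bool using (Bool; true; false; _∧_; _∨_; not; if_then_else_)
open import Data.Nat using (ℕ; zero; suc; _+_; _∸_; _⊔_; _≡ᵇ_; _<ᵇ_; _≤ᵇ_)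
open import Data.Nat.DivMod using (_/_; _%_)
open import Data.Fin using (Fin; toℕ)
open import Data.List using (List; map; foldr)
open import Data.Nat.ListAction using (sum; product)
open import Data.Bool.ListAction using (any)
open import Data.List.Base using () renaming (allFin to allFinL)
open import Data.Integer using (+_)
open import Data.Rational using (ℚ; 0ℚ) renaming (_+_ to _+ℚ_; _/_ to _/ℚ_)

-- Finite simple graphs on the vertex set Fin n, given by a Boolean
-- adjacency function (assumed symmetric and irreflexive for the
-- concrete graphs below, which is the case by construction).

Graph : ℕ → Set
Graph n = Fin n → Fin n → Bool

vertices : (n : ℕ) → List (Fin n)
vertices n = allFinL n

degree : ∀ {n} → Graph n → Fin n → ℕ
degree {n} G u = sum (map (λ v → if G u v then 1 else 0) (vertices n))

M : ∀ {n} → Graph n → Fin n → ℕ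
M {n} G u = product (map (λ v → if G u v then degree G v else 1) (vertices n))

ball : ∀ {n} → Graph n → Fin n → ℕ → Fin n → Bool
ball G u zero    v = toℕ u ≡ᵇ toℕ v
ball {n} G u (suc k) v = ball G u k v ∨ any (λ w → ball G u k w ∧ G w v) (vertices n)

-- d(u,v) : the least k with d(u,v) ≤ k, searched among k = 0,1,…,n
-- (in a connected graph on n vertices the distance is < n)
distFrom : ∀ {n} → Graph n → Fin n → Fin n → ℕ → ℕ → ℕ
distFrom G u v k zero       = k
distFrom G u v k (suc fuel) = if ball G u k v then k else distFrom G u v (suc k) fuel

dist : ∀ {n} → Graph n → Fin n → Fin n → ℕ
dist {n} G u v = distFrom G u v 0 n

ecc : ∀ {n} → Graph n → Fin n → ℕ
ecc {n} G u = foldr _⊔_ 0 (map (dist G u) (vertices n))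

-- m / e as a rational (e = 0 never occurs for the graphs considered
-- here, which are connected with n ≥ 5 vertices)
frac : ℕ → ℕ → ℚ
frac m zero    = 0ℚ
frac m (suc e) = (+ m) /ℚ (suc e)

ξac : ∀ {n} → Graph n → ℚ
ξac {n} G = foldr _+ℚ_ 0ℚ (map (λ u → frac (M G u) (ecc G u)) (vertices n))

starAdjℕ : ℕ → ℕ → Bool
starAdjℕ i j = ((i ≡ᵇ 0) ∧ not (j ≡ᵇ 0)) ∨ ((j ≡ᵇ 0) ∧ not (i ≡ᵇ 0))

S : (n : ℕ) → Graph n
S n u v = starAdjℕ (toℕ u) (toℕ v)

-- The degree balanced tree TB_{n,k}:
--   vertex 0 is the central vertex,
--   vertices 1,…,k are its neighbours,
--   vertices k+1,…,n-1 are leaves, leaf j being attached to the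
--   neighbour 1 + ((j - k - 1) mod k).
-- Hence the neighbours 1,…,k receive ⌊(n-1-k)/k⌋ or ⌈(n-1-k)/k⌉ leaves
-- each, so their degrees differ pairwise by at most one.

parent : ℕ → ℕ → ℕ
parent zero    j = 0
parent (suc k) j = suc ((j ∸ suc (suc k)) % suc k)

childEdge : ℕ → ℕ → ℕ → Bool
childEdge k i j = (1 ≤ᵇ i) ∧ (i ≤ᵇ k) ∧ (k <ᵇ j) ∧ (i ≡ᵇ parent k j)

centreEdge : ℕ → ℕ → ℕ → Bool
centreEdge k i j = (i ≡ᵇ 0) ∧ (1 ≤ᵇ j) ∧ (j ≤ᵇ k)

tbAdjℕ : ℕ → ℕ → ℕ → Bool
tbAdjℕ k i j = centreEdge k i j ∨ centreEdge k j i ∨ childEdge k i j ∨ childEdge k j i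

TB : (n k : ℕ) → Graph n
TB n k u v = tbAdjℕ k (toℕ u) (toℕ v)

⌈_/3⌉ : ℕ → ℕ
⌈ m /3⌉ = (m + 2) / 3

module Submission where

-- Every term M(u)/ε(u) of ξ^{ac}(S_n) is small: the centre gives 1/ε ≤ 1 and each of the n − 1
-- leaves gives (n − 1)/ε ≤ (n − 1)/2, so ξ^{ac}(S_n) ≤ (2 + (n − 1)²)/2.  In TB_{n,k} with
-- k = ⌈(n − 1)/3⌉ write n − 1 = 2k + a and b = k − a: the centre has eccentricity 2, and a of its
-- neighbours have degree 3 and b have degree 2, so its term alone gives ξ^{ac}(TB_{n,k}) ≥ 3^a 2^b / 2.
-- In each residue class of n − 1 mod 3 the product 3^a 2^b grows by a factor 3 when n grows by 3,
-- faster than 2 + (n − 1)², and it is already larger at n = 16, 17, 18; the cases 5 ≤ n ≤ 15 are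
-- decided by evaluation.

open import Defs

-- Kept in an anonymous module so that ℕ's _<_ opened here does not clash with ℚ's _<_ in lemma10.
module _ where

  open import Data.Bool using (Bool; true; false; T; _∧_; _∨_; if_then_else_)
  open import Data.Bool.Properties using (T-∧; T-∨; ∨-comm; ∨-assoc)
  open import Data.Empty using (⊥-elim)
  import Data.Integer as ℤ
  import Data.Integer.Properties as ℤ
  open import Data.Integer.Tactic.RingSolver renaming (solve-∀ to ℤ-solve-∀)
  open import Data.Rational as ℚ using (ℚ; 0ℚ; fromℚᵘ)
  import Data.Rational.Properties as ℚ
  open import Data.Rational.Unnormalised as ℚᵘ using (mkℚᵘ)
  import Data.Rational.Unnormalised.Properties as ℚᵘ
  open import Data.Fin using (Fin; toℕ; fromℕ<) renaming (zero to fzero; suc to fsuc)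
  open import Data.Fin.Properties using (toℕ-fromℕ<)
  open import Data.List using (allFin; upTo; []; _∷_; map; foldr; tabulate; length)
  open import Data.List.Membership.Propositional using (_∈_; lose)
  open import Data.List.Membership.Propositional.Properties using (∈-allFin; ∈-map⁺; ∈-upTo⁺)
  open import Data.List.Properties using (map-tabulate; tabulate-cong; length-tabulate)
  open import Data.List.Relation.Unary.All using (All; []; _∷_; all?; lookup)
  open import Data.List.Relation.Unary.All.Properties using (tabulate⁺)
  open import Data.List.Relation.Unary.Any using (here; there; satisfied)
  open import Data.List.Relation.Unary.Any.Properties using (any⁺; any⁻)
  open import Data.Nat
  open import Data.Nat.DivMod using (_/_; _%_; m≡m%n+[m/n]*n; m%n<n; m<n⇒m%n≡m; [m+kn]%n≡m%n; /-congˡ; +-distrib-/-∣ʳ; m*n/n≡m)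
  open import Data.Nat.Divisibility using (divides-refl)
  open import Data.Nat.Tactic.RingSolver using (solve-∀)
  open import Data.Nat.ListAction using (sum; product)
  open import Data.Nat.Properties
  open import Data.Product using (_,_; proj₂; uncurry)
  open import Data.Sum using (inj₁; inj₂)
  open import Function using (_∘_)
  open import Function.Bundles using (Equivalence)
  open import Relation.Binary.PropositionalEquality
  open import Relation.Nullary using (¬_; Dec; yes; no; ¬?; _→-dec_)
  open import Relation.Nullary.Decidable using (from-yes; decidable-stable)

  sumBelow : ℕ → (ℕ → ℕ) → ℕ
  sumBelow zero    f = 0
  sumBelow (suc n) f = f 0 + sumBelow n (f ∘ suc)

  productBelow : ℕ → (ℕ → ℕ) → ℕ
  productBelow zero    f = 1
  productBelow (suc n) f = f 0 * productBelow n (f ∘ suc)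

  sum-tabulate-toℕ : ∀ n (f : ℕ → ℕ) → sum (tabulate {n = n} (f ∘ toℕ)) ≡ sumBelow n f
  sum-tabulate-toℕ zero    f = refl
  sum-tabulate-toℕ (suc n) f = cong (f 0 +_) (sum-tabulate-toℕ n (f ∘ suc))

  product-tabulate-toℕ : ∀ n (f : ℕ → ℕ) → product (tabulate {n = n} (f ∘ toℕ)) ≡ productBelow n f
  product-tabulate-toℕ zero    f = refl
  product-tabulate-toℕ (suc n) f = cong (f 0 *_) (product-tabulate-toℕ n (f ∘ suc))

  sumBelow-const : ∀ n {c} {f : ℕ → ℕ} → (∀ i → f i ≡ c) → sumBelow n f ≡ n * c
  sumBelow-const zero    fi≡c = refl
  sumBelow-const (suc n) fi≡c = cong₂ _+_ (fi≡c 0) (sumBelow-const n (fi≡c ∘ suc))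

  productBelow-const : ∀ n {c} {f : ℕ → ℕ} → (∀ i → f i ≡ c) → productBelow n f ≡ c ^ n
  productBelow-const zero    fi≡c = refl
  productBelow-const (suc n) fi≡c = cong₂ _*_ (fi≡c 0) (productBelow-const n (fi≡c ∘ suc))

  productBelow-+ : ∀ m n (f : ℕ → ℕ) →
                   productBelow (m + n) f ≡ productBelow m f * productBelow n (f ∘ (m +_))
  productBelow-+ zero    n f = sym (+-identityʳ _)
  productBelow-+ (suc m) n f =
    trans (cong (f 0 *_) (productBelow-+ m n (f ∘ suc))) (sym (*-assoc (f 0) _ _))

  ^≤productBelow : ∀ n {c} {f : ℕ → ℕ} → (∀ {i} → i < n → c ≤ f i) → c ^ n ≤ productBelow n f
  ^≤productBelow zero    c≤f = ≤-refl
  ^≤productBelow (suc n) c≤f = *-mono-≤ (c≤f z<s) (^≤productBelow n (c≤f ∘ s<s))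

  ≤sumBelow : ∀ {n i} (f : ℕ → ℕ) → i < n → f i ≤ sumBelow n f
  ≤sumBelow {i = zero}  f (s≤s _)   = m≤m+n _ _
  ≤sumBelow {i = suc i} f (s≤s i<n) = ≤-trans (≤sumBelow (f ∘ suc) i<n) (m≤n+m _ _)

  +≤sumBelow : ∀ {n i j} (f : ℕ → ℕ) → i < j → j < n → f i + f j ≤ sumBelow n f
  +≤sumBelow {suc n} {zero}  {suc j} f _         (s≤s j<n) = +-monoʳ-≤ (f 0) (≤sumBelow (f ∘ suc) j<n)
  +≤sumBelow {suc n} {suc i} {suc j} f (s≤s i<j) (s≤s j<n) =
    ≤-trans (+≤sumBelow (f ∘ suc) i<j j<n) (m≤n+m _ _)

  -- S n and TB n k are definitionally fromRel n starAdjℕ and fromRel n (tbAdjℕ k).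
  fromRel : (n : ℕ) → (ℕ → ℕ → Bool) → Graph n
  fromRel n A u v = A (toℕ u) (toℕ v)

  indicator : Bool → ℕ
  indicator b = if b then 1 else 0

  degreeRel : (ℕ → ℕ → Bool) → ℕ → ℕ → ℕ
  degreeRel A n x = sumBelow n (indicator ∘ A x)

  MRel : (ℕ → ℕ → Bool) → ℕ → ℕ → ℕ
  MRel A n x = productBelow n (λ y → if A x y then degreeRel A n y else 1)

  degree-fromRel : ∀ n A (u : Fin n) → degree (fromRel n A) u ≡ degreeRel A n (toℕ u)
  degree-fromRel n A u =
    trans (cong sum (map-tabulate {n = n} (λ v → v) _)) (sum-tabulate-toℕ n (indicator ∘ A (toℕ u)))

  M-fromRel : ∀ n A (u : Fin n) → M (fromRel n A) u ≡ MRel A n (toℕ u)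
  M-fromRel n A u = begin
    M (fromRel n A) u
      ≡⟨ cong product (map-tabulate {n = n} (λ v → v) _) ⟩
    product (tabulate {n = n} (λ v → if A (toℕ u) (toℕ v) then degree (fromRel n A) v else 1))
      ≡⟨ cong product (tabulate-cong {n = n} λ v → cong (if A (toℕ u) (toℕ v) then_else 1) (degree-fromRel n A v)) ⟩
    product (tabulate {n = n} (λ v → if A (toℕ u) (toℕ v) then degreeRel A n (toℕ v) else 1))
      ≡⟨ product-tabulate-toℕ n _ ⟩
    MRel A n (toℕ u) ∎
    where open ≡-Reasoning

  module _ {n} (G : Graph n) (u : Fin n) where

    ball-step : ∀ {k w v} → T (ball G u k w) → T (G w v) → T (ball G u (suc k) v)
    ball-step {w = w} uw wv =
      Equivalence.from T-∨ (inj₂ (any⁺ _ (lose (∈-allFin w) (Equivalence.from T-∧ (uw , wv)))))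

    ball-mono : ∀ {j k v} → j ≤′ k → T (ball G u j v) → T (ball G u k v)
    ball-mono ≤′-refl       uv = uv
    ball-mono (≤′-step j≤k) uv = Equivalence.from T-∨ (inj₁ (ball-mono j≤k uv))

    <-distFrom : ∀ {d v} k fuel → d < k + fuel → ¬ T (ball G u d v) → d < distFrom G u v k fuel
    <-distFrom k zero d<k _ = subst (_ <_) (+-identityʳ k) d<k
    <-distFrom {d} {v} k (suc fuel) d<k+1+f far with ball G u k v in eq
    ... | true  = ≰⇒> λ k≤d → far (ball-mono (≤⇒≤′ k≤d) (subst T (sym eq) _))
    ... | false = <-distFrom (suc k) fuel (subst (d <_) (+-suc k fuel) d<k+1+f) far

    distFrom≤ : ∀ {k v} j fuel → j ≤ k → k < j + fuel → T (ball G u k v) → distFrom G u v j fuel ≤ k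
    distFrom≤ j zero j≤k k<j+0 _ = ⊥-elim (<⇒≱ k<j+0 (subst (_≤ _) (sym (+-identityʳ j)) j≤k))
    distFrom≤ {k} {v} j (suc fuel) j≤k k<j+1+f uv with ball G u j v in eq
    ... | true  = j≤k
    ... | false = distFrom≤ (suc j) fuel (≤∧≢⇒< j≤k j≢k) (subst (k <_) (+-suc j fuel) k<j+1+f) uv
      where
      j≢k : j ≢ k
      j≢k refl = subst T eq uv

    dist≤ecc : ∀ v → dist G u v ≤ ecc G u
    dist≤ecc v = ≤-foldr-⊔ (∈-map⁺ (dist G u) (∈-allFin v))
      where
      ≤-foldr-⊔ : ∀ {x xs} → x ∈ xs → x ≤ foldr _⊔_ 0 xs
      ≤-foldr-⊔ (here refl)  = m≤m⊔n _ _
      ≤-foldr-⊔ (there x∈xs) = ≤-trans (≤-foldr-⊔ x∈xs) (m≤n⊔m _ _)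

    <-ecc : ∀ {d v} → d < n → ¬ T (ball G u d v) → d < ecc G u
    <-ecc {v = v} d<n far = <-≤-trans (<-distFrom 0 n d<n far) (dist≤ecc v)

    ecc≤ : ∀ {k} → k < n → (∀ v → T (ball G u k v)) → ecc G u ≤ k
    ecc≤ {k} k<n within = foldr-⊔-≤ (allFin n) (λ v → distFrom≤ 0 n z≤n k<n (within v))
      where
      foldr-⊔-≤ : ∀ vs → (∀ v → dist G u v ≤ k) → foldr _⊔_ 0 (map (dist G u) vs) ≤ k
      foldr-⊔-≤ []       _ = z≤n
      foldr-⊔-≤ (v ∷ vs) h = ⊔-lub (h v) (foldr-⊔-≤ vs h)

  0<ecc : ∀ {n} (G : Graph (2 + n)) → 0 < ecc G fzero
  0<ecc G = <-ecc G fzero {0} {fsuc fzero} z<s λ ()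

  fromℚᵘ-mono-≤ : ∀ {p q} → p ℚᵘ.≤ q → fromℚᵘ p ℚ.≤ fromℚᵘ q
  fromℚᵘ-mono-≤ {p} {q} p≤q = ℚ.toℚᵘ-cancel-≤
    (ℚᵘ.≤-respˡ-≃ (ℚᵘ.≃-sym (ℚ.toℚᵘ-fromℚᵘ p)) (ℚᵘ.≤-respʳ-≃ (ℚᵘ.≃-sym (ℚ.toℚᵘ-fromℚᵘ q)) p≤q))

  fromℚᵘ-mono-< : ∀ {p q} → p ℚᵘ.< q → fromℚᵘ p ℚ.< fromℚᵘ q
  fromℚᵘ-mono-< {p} {q} p<q = ℚ.toℚᵘ-cancel-<
    (ℚᵘ.<-respˡ-≃ (ℚᵘ.≃-sym (ℚ.toℚᵘ-fromℚᵘ p)) (ℚᵘ.<-respʳ-≃ (ℚᵘ.≃-sym (ℚ.toℚᵘ-fromℚᵘ q)) p<q))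

  frac-mono-≤ : ∀ {m m' e e'} → 0 < e → 0 < e' → m * e' ≤ m' * e → frac m e ℚ.≤ frac m' e'
  frac-mono-≤ {m} {m'} {suc d} {suc d'} _ _ h =
    fromℚᵘ-mono-≤ {mkℚᵘ (ℤ.+ m) d} {mkℚᵘ (ℤ.+ m') d'}
      (ℚᵘ.*≤* (subst₂ ℤ._≤_ (ℤ.pos-* m (suc d')) (ℤ.pos-* m' (suc d)) (ℤ.+≤+ h)))

  frac-mono-< : ∀ {m m' e e'} → 0 < e → 0 < e' → m * e' < m' * e → frac m e ℚ.< frac m' e'
  frac-mono-< {m} {m'} {suc d} {suc d'} _ _ h =
    fromℚᵘ-mono-< {mkℚᵘ (ℤ.+ m) d} {mkℚᵘ (ℤ.+ m') d'}
      (ℚᵘ.*<* (subst₂ ℤ._<_ (ℤ.pos-* m (suc d')) (ℤ.pos-* m' (suc d)) (ℤ.+<+ h)))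

  0≤frac : ∀ m e → 0ℚ ℚ.≤ frac m e
  0≤frac m zero    = ℚ.≤-refl
  0≤frac m (suc d) = subst (ℚ._≤ frac m (suc d)) (ℚ.0/n≡0 1) (frac-mono-≤ {0} {m} {1} {suc d} z<s z<s z≤n)

  frac-+ : ∀ a b d → frac a (suc d) ℚ.+ frac b (suc d) ≡ frac (a + b) (suc d)
  frac-+ a b d = ℚ.toℚᵘ-injective (begin
    ℚ.toℚᵘ (frac a (suc d) ℚ.+ frac b (suc d))
      ≈⟨ ℚ.toℚᵘ-homo-+ (frac a (suc d)) (frac b (suc d)) ⟩
    ℚ.toℚᵘ (frac a (suc d)) ℚᵘ.+ ℚ.toℚᵘ (frac b (suc d))
      ≈⟨ ℚᵘ.+-cong (ℚ.toℚᵘ-fromℚᵘ (mkℚᵘ (ℤ.+ a) d)) (ℚ.toℚᵘ-fromℚᵘ (mkℚᵘ (ℤ.+ b) d)) ⟩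
    mkℚᵘ (ℤ.+ a) d ℚᵘ.+ mkℚᵘ (ℤ.+ b) d
      ≈⟨ ℚᵘ.*≡* (sum-identity (ℤ.+ a) (ℤ.+ b) (ℤ.+ suc d)) ⟩
    mkℚᵘ (ℤ.+ (a + b)) d
      ≈⟨ ℚ.toℚᵘ-fromℚᵘ (mkℚᵘ (ℤ.+ (a + b)) d) ⟨
    ℚ.toℚᵘ (frac (a + b) (suc d)) ∎)
    where
    open ℚᵘ.≃-Reasoning
    sum-identity : ∀ x y e → (x ℤ.* e ℤ.+ y ℤ.* e) ℤ.* e ≡ (x ℤ.+ y) ℤ.* (e ℤ.* e)
    sum-identity = ℤ-solve-∀

  module _ {A : Set} (g : A → ℚ) where

    foldr-+-≤ : ∀ {c} d {xs} → All (λ x → g x ℚ.≤ frac c (suc d)) xs →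
                foldr ℚ._+_ 0ℚ (map g xs) ℚ.≤ frac (length xs * c) (suc d)
    foldr-+-≤ d []                        = ℚ.≤-reflexive (sym (ℚ.0/n≡0 (suc d)))
    foldr-+-≤ {c} d {_ ∷ xs} (gx≤c ∷ g≤c) =
      subst (_ ℚ.≤_) (frac-+ c (length xs * c) d) (ℚ.+-mono-≤ gx≤c (foldr-+-≤ d g≤c))

    0≤foldr-+ : ∀ xs → (∀ x → 0ℚ ℚ.≤ g x) → 0ℚ ℚ.≤ foldr ℚ._+_ 0ℚ (map g xs)
    0≤foldr-+ []       _    = ℚ.≤-refl
    0≤foldr-+ (x ∷ xs) 0≤g =
      subst (ℚ._≤ foldr ℚ._+_ 0ℚ (map g (x ∷ xs))) (ℚ.+-identityʳ 0ℚ) (ℚ.+-mono-≤ (0≤g x) (0≤foldr-+ xs 0≤g))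

  degree-star-centre : ∀ N → degreeRel starAdjℕ (suc N) 0 ≡ N
  degree-star-centre N = trans (sumBelow-const N λ _ → refl) (*-identityʳ N)

  degree-star-leaf : ∀ N x → degreeRel starAdjℕ (suc N) (suc x) ≡ 1
  degree-star-leaf N x = cong suc (trans (sumBelow-const N λ _ → refl) (*-zeroʳ N))

  M-star-centre : ∀ N → M (S (suc N)) fzero ≡ 1
  M-star-centre N = trans (M-fromRel (suc N) starAdjℕ fzero)
    (trans (+-identityʳ _) (trans (productBelow-const N (degree-star-leaf N)) (^-zeroˡ N)))

  M-star-leaf : ∀ N (i : Fin N) → M (S (suc N)) (fsuc i) ≡ N
  M-star-leaf N i = begin
    M (S (suc N)) (fsuc i)                                   ≡⟨ M-fromRel (suc N) starAdjℕ (fsuc i) ⟩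
    degreeRel starAdjℕ (suc N) 0 * productBelow N (λ _ → 1) ≡⟨ cong₂ _*_ (degree-star-centre N) (productBelow-const N λ _ → refl) ⟩
    N * 1 ^ N                                                ≡⟨ cong (N *_) (^-zeroˡ N) ⟩
    N * 1                                                    ≡⟨ *-identityʳ N ⟩
    N                                                        ∎
    where open ≡-Reasoning

  star-leaves-far : ∀ {N} (i j : Fin N) → toℕ i ≢ toℕ j → ¬ T (ball (S (suc N)) (fsuc i) 1 (fsuc j))
  star-leaves-far {N} i j i≢j within with Equivalence.to T-∨ within
  ... | inj₁ i≡j  = i≢j (≡ᵇ⇒≡ (toℕ i) (toℕ j) i≡j)
  ... | inj₂ path = uncurry no-path (satisfied (any⁻ _ (allFin (suc N)) path))
    where
    no-path : ∀ w → ¬ T (ball (S (suc N)) (fsuc i) 0 w ∧ S (suc N) w (fsuc j))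
    no-path fzero    ()
    no-path (fsuc w) t = proj₂ (Equivalence.to T-∧ t)

  ξac-star≤ : ∀ {N} → 2 ≤ N → ξac (S (suc N)) ℚ.≤ frac (2 + N * N) 2
  ξac-star≤ {suc (suc m)} (s≤s (s≤s z≤n)) = subst (ξac G ℚ.≤_) (frac-+ 2 (N * N) 1)
    (ℚ.+-mono-≤ centre≤ (subst (λ l → leaves ℚ.≤ frac (l * N) 2) (length-tabulate {n = N} fsuc) leaves≤))
    where
    N = 2 + m
    G = S (suc N)
    term : Fin (suc N) → ℚ
    term u = frac (M G u) (ecc G u)
    1<ecc-leaf : ∀ i → 1 < ecc G (fsuc i)
    1<ecc-leaf fzero    = <-ecc G (fsuc fzero) {1} {fsuc (fsuc fzero)} (s<s z<s) (star-leaves-far {N} fzero (fsuc fzero) λ ())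
    1<ecc-leaf (fsuc i) = <-ecc G (fsuc (fsuc i)) {1} {fsuc fzero} (s<s z<s) (star-leaves-far {N} (fsuc i) fzero λ ())
    centre≤ : term fzero ℚ.≤ frac 2 2
    centre≤ = frac-mono-≤ {m' = 2} {e' = 2} (0<ecc G) z<s
      (subst (λ x → x * 2 ≤ 2 * ecc G fzero) (sym (M-star-centre N))
        (*-monoʳ-≤ 2 (0<ecc G)))
    leaf≤ : ∀ i → term (fsuc i) ℚ.≤ frac N 2
    leaf≤ i = frac-mono-≤ {m' = N} {e' = 2} (<-trans z<s (1<ecc-leaf i)) z<s
      (subst (λ x → x * 2 ≤ N * ecc G (fsuc i)) (sym (M-star-leaf N i))
        (*-monoʳ-≤ N (1<ecc-leaf i)))
    leaves : ℚ
    leaves = foldr ℚ._+_ 0ℚ (map term (tabulate fsuc))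
    leaves≤ : leaves ℚ.≤ frac (length (tabulate {n = N} fsuc) * N) 2
    leaves≤ = foldr-+-≤ term {N} 1 (tabulate⁺ {f = fsuc} leaf≤)

  tbAdj-sym : ∀ k i j → tbAdjℕ k i j ≡ tbAdjℕ k j i
  tbAdj-sym k i j = begin
    a ∨ b ∨ c ∨ d   ≡⟨ cong (λ z → a ∨ b ∨ z) (∨-comm c d) ⟩
    a ∨ b ∨ d ∨ c   ≡⟨ ∨-assoc a b (d ∨ c) ⟨
    (a ∨ b) ∨ d ∨ c ≡⟨ cong (_∨ d ∨ c) (∨-comm a b) ⟩
    (b ∨ a) ∨ d ∨ c ≡⟨ ∨-assoc b a (d ∨ c) ⟩
    b ∨ a ∨ d ∨ c   ∎
    where
    open ≡-Reasoning
    a = centreEdge k i j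
    b = centreEdge k j i
    c = childEdge k i j
    d = childEdge k j i

  centre-adj : ∀ {k' x} → x < suc k' → T (tbAdjℕ (suc k') 0 (suc x))
  centre-adj x<k = Equivalence.from T-∨ (inj₁ (≤⇒≤ᵇ x<k))

  child-adj : ∀ {k' x} c → x < suc k' → T (tbAdjℕ (suc k') (suc x) (suc (x + suc c * suc k')))
  child-adj {k'} {x} c x<k = Equivalence.from T-∨ (inj₁ (Equivalence.from T-∧
    (≤⇒≤ᵇ x<k , Equivalence.from T-∧ (<⇒<ᵇ k<j , ≡⇒≡ᵇ (suc x) _ (cong suc (sym x-is-parent))))))
    where
    K = suc k'
    k<j : K < suc (x + suc c * K)
    k<j = s≤s (≤-trans (m≤m+n K (c * K)) (m≤n+m (suc c * K) x))
    x-is-parent : (x + suc c * K ∸ K) % K ≡ x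
    x-is-parent = begin
      (x + suc c * K ∸ K) % K   ≡⟨ cong (λ z → (z ∸ K) % K) (reorder x c K) ⟩
      (K + (x + c * K) ∸ K) % K ≡⟨ cong (_% K) (m+n∸m≡n K (x + c * K)) ⟩
      (x + c * K) % K           ≡⟨ [m+kn]%n≡m%n x c K ⟩
      x % K                     ≡⟨ m<n⇒m%n≡m x<k ⟩
      x                         ∎
      where
      open ≡-Reasoning
      reorder : ∀ x c K → x + suc c * K ≡ K + (x + c * K)
      reorder = solve-∀

  parent-adj : ∀ {k' j} → suc k' < j → T (tbAdjℕ (suc k') (parent (suc k') j) j)
  parent-adj {k'} {suc j} k<j = Equivalence.from T-∨ (inj₁ (Equivalence.from T-∧
    (≤⇒≤ᵇ (m%n<n (j ∸ suc k') (suc k')) , Equivalence.from T-∧ (<⇒<ᵇ k<j , ≡⇒≡ᵇ p p refl))))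
    where p = suc ((j ∸ suc k') % suc k')

  ecc-tb-centre≤2 : ∀ {n k'} → 2 < suc n → suc k' < suc n → ecc (TB (suc n) (suc k')) fzero ≤ 2
  ecc-tb-centre≤2 {n} {k'} 2<n k<n = ecc≤ G fzero 2<n within₂
    where
    G = TB (suc n) (suc k')
    K = suc k'
    within₁ : ∀ (v : Fin (suc n)) {x} → toℕ v ≡ suc x → x < K → T (ball G fzero 1 v)
    within₁ v v≡1+x x<k =
      ball-step G fzero {0} {fzero} {v} _ (subst (T ∘ tbAdjℕ K 0) (sym v≡1+x) (centre-adj x<k))
    within₂ : ∀ v → T (ball G fzero 2 v)
    within₂ fzero = ball-mono G fzero {0} {2} {fzero} (≤′-step (≤′-step ≤′-refl)) _
    within₂ (fsuc v) with suc (toℕ v) ≤? K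
    ... | yes v<k = ball-mono G fzero {1} {2} {fsuc v} (≤′-step ≤′-refl) (within₁ (fsuc v) refl v<k)
    ... | no  v≮k = ball-step G fzero {1} {p} {fsuc v} (within₁ p (toℕ-fromℕ< p<n) r<k)
      (subst (λ z → T (tbAdjℕ K z (suc (toℕ v)))) (sym (toℕ-fromℕ< p<n)) (parent-adj (≰⇒> v≮k)))
      where
      r<k : (toℕ v ∸ K) % K < K
      r<k = m%n<n (toℕ v ∸ K) K
      p<n : suc ((toℕ v ∸ K) % K) < suc n
      p<n = ≤-trans (s≤s r<k) k<n
      p : Fin (suc n)
      p = fromℕ< p<n

  indicator-T : ∀ {b} → T b → indicator b ≡ 1
  indicator-T {true} _ = refl

  if-T : ∀ {b} {A : Set} {x y : A} → T b → (if b then x else y) ≡ x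
  if-T {true} _ = refl

  1≤M-factor : ∀ {A} → (∀ i j → A i j ≡ A j i) → ∀ {n x} y → x < n →
               1 ≤ (if A x y then degreeRel A n y else 1)
  1≤M-factor {A} A-sym {n} {x} y x<n with A x y in xy
  ... | false = ≤-refl
  ... | true  = subst (_≤ degreeRel A n y) (cong indicator (trans (A-sym y x) xy)) (≤sumBelow (indicator ∘ A y) x<n)

  module _ {k' N x : ℕ} (x<k : x < suc k') where

    private
      K = suc k'
      f = indicator ∘ tbAdjℕ K (suc x)
      centre-ind : indicator (tbAdjℕ K (suc x) 0) ≡ 1
      centre-ind = indicator-T (subst T (tbAdj-sym K 0 (suc x)) (centre-adj x<k))
      child-ind : ∀ c → f (suc (x + suc c * K)) ≡ 1
      child-ind c = indicator-T (child-adj c x<k)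

    2≤degree-neighbour : x + 1 * K < N → 2 ≤ degreeRel (tbAdjℕ K) (suc N) (suc x)
    2≤degree-neighbour j<N = +-mono-≤ (≤-reflexive (sym centre-ind))
      (subst (_≤ sumBelow N (f ∘ suc)) (child-ind 0) (≤sumBelow (f ∘ suc) j<N))

    3≤degree-neighbour : x + 2 * K < N → 3 ≤ degreeRel (tbAdjℕ K) (suc N) (suc x)
    3≤degree-neighbour j<N = +-mono-≤ (≤-reflexive (sym centre-ind))
      (subst (_≤ sumBelow N (f ∘ suc)) (cong₂ _+_ (child-ind 0) (child-ind 1))
        (+≤sumBelow (f ∘ suc) (+-monoʳ-< x (*-monoˡ-< K {1} {2} (s≤s (s≤s z≤n)))) j<N))

  -- Neighbours 1, …, a of the centre carry two leaves each and neighbours a + 1, …, k one leaf.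
  M-tb-centre≥ : ∀ {k' a b} → a + b ≡ suc k' →
                 3 ^ a * 2 ^ b ≤ M (TB (suc (suc k' + (suc k' + a))) (suc k')) fzero
  M-tb-centre≥ {k'} {a} {b} a+b≡k = begin
    3 ^ a * 2 ^ b                                    ≡⟨ pad (3 ^ a) (2 ^ b) (K + a) ⟩
    1 * (3 ^ a * (2 ^ b * 1 ^ (K + a)))              ≤⟨ *-mono-≤ (1≤M-factor (tbAdj-sym K) {suc N} 0 z<s) (*-mono-≤
                                                          (^≤productBelow a neighbour≥3)
                                                          (*-mono-≤ (^≤productBelow b neighbour≥2) (^≤productBelow (K + a) factor≥1))) ⟩
    f 0 * (productBelow a g * (productBelow b (g ∘ (a +_)) * productBelow (K + a) (g ∘ (a +_) ∘ (b +_))))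
                                                     ≡⟨ cong (f 0 *_) split ⟨
    f 0 * productBelow N g                           ≡⟨ M-fromRel (suc N) A fzero ⟨
    M (TB (suc N) K) fzero                           ∎
    where
    open ≤-Reasoning
    K = suc k'
    N = K + (K + a)
    A = tbAdjℕ K
    f : ℕ → ℕ
    f y = if A 0 y then degreeRel A (suc N) y else 1
    g = f ∘ suc
    pad : ∀ x y z → x * y ≡ 1 * (x * (y * 1 ^ z))
    pad x y z = trans (unit-factors x y) (cong (λ w → 1 * (x * (y * w))) (sym (^-zeroˡ z)))
      where
      unit-factors : ∀ x y → x * y ≡ 1 * (x * (y * 1))
      unit-factors = solve-∀
    split : productBelow N g ≡ productBelow a g * (productBelow b (g ∘ (a +_)) * productBelow (K + a) (g ∘ (a +_) ∘ (b +_)))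
    split = trans (cong (λ m → productBelow m g) (trans (cong (_+ (K + a)) (sym a+b≡k)) (+-assoc a b (K + a))))
            (trans (productBelow-+ a (b + (K + a)) g) (cong (productBelow a g *_) (productBelow-+ b (K + a) (g ∘ (a +_)))))
    neighbour≥3 : ∀ {x} → x < a → 3 ≤ g x
    neighbour≥3 {x} x<a = subst (3 ≤_) (sym (if-T (centre-adj x<k))) (3≤degree-neighbour x<k leaf₂<N)
      where
      x<k : x < K
      x<k = <-≤-trans x<a (subst (a ≤_) a+b≡k (m≤m+n a b))
      leaf₂<N : x + 2 * K < N
      leaf₂<N = subst (x + 2 * K <_) (two-steps a K) (+-monoˡ-< (2 * K) x<a)
        where
        two-steps : ∀ a K → a + 2 * K ≡ K + (K + a)
        two-steps = solve-∀
    neighbour≥2 : ∀ {x} → x < b → 2 ≤ g (a + x)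
    neighbour≥2 {x} x<b = subst (2 ≤_) (sym (if-T (centre-adj a+x<k))) (2≤degree-neighbour a+x<k leaf₁<N)
      where
      a+x<k : a + x < K
      a+x<k = subst (a + x <_) a+b≡k (+-monoʳ-< a x<b)
      leaf₁<N : a + x + 1 * K < N
      leaf₁<N = <-≤-trans (+-monoˡ-< (1 * K) a+x<k) (+-monoʳ-≤ K (+-monoʳ-≤ K z≤n))
    factor≥1 : ∀ {x} → x < K + a → 1 ≤ g (a + (b + x))
    factor≥1 {x} _ = 1≤M-factor (tbAdj-sym K) {suc N} (suc (a + (b + x))) z<s

  ξac-tb≥ : ∀ {n k' P} → 2 ≤ n → suc k' < suc n → P ≤ M (TB (suc n) (suc k')) fzero →
            frac P 2 ℚ.≤ ξac (TB (suc n) (suc k'))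
  ξac-tb≥ {suc (suc m)} {k'} {P} (s≤s (s≤s z≤n)) k<n P≤M =
    ℚ.≤-trans centre≥ (subst (ℚ._≤ term fzero ℚ.+ rest) (ℚ.+-identityʳ (term fzero))
      (ℚ.+-mono-≤ (ℚ.≤-refl {term fzero}) (0≤foldr-+ term (tabulate fsuc) λ u → 0≤frac (M G u) (ecc G u))))
    where
    G = TB (3 + m) (suc k')
    term : Fin (3 + m) → ℚ
    term u = frac (M G u) (ecc G u)
    rest = foldr ℚ._+_ 0ℚ (map term (tabulate fsuc))
    centre≥ : frac P 2 ℚ.≤ term fzero
    centre≥ = frac-mono-≤ {P} {M G fzero} {2} z<s (0<ecc G)
      (*-mono-≤ P≤M (ecc-tb-centre≤2 (s≤s (s≤s (s≤s z≤n))) k<n))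

  star<tb : ∀ {N k' a b} → a + b ≡ suc k' → N ≡ suc k' + (suc k' + a) → 2 + N * N < 3 ^ a * 2 ^ b →
            ξac (S (suc N)) ℚ.< ξac (TB (suc N) (suc k'))
  star<tb {N} {k'} {a} {b} a+b≡k refl N²<3ᵃ2ᵇ =
    ℚ.≤-<-trans (ξac-star≤ 2≤N) (ℚ.<-≤-trans (frac-mono-< {2 + N * N} {3 ^ a * 2 ^ b} {2} {2} z<s z<s (*-monoˡ-< 2 N²<3ᵃ2ᵇ))
      (ξac-tb≥ {P = 3 ^ a * 2 ^ b} 2≤N (s≤s (m≤m+n (suc k') (suc k' + a)))
        (M-tb-centre≥ a+b≡k)))
    where
    2≤N : 2 ≤ suc k' + (suc k' + a)
    2≤N = s≤s (≤-trans (s≤s z≤n) (m≤n+m (suc (k' + a)) k'))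

  3^-dominates : ∀ (g : ℕ → ℕ) q₀ c → g 0 < 3 ^ q₀ * c → (∀ t → g (suc t) ≤ 3 * g t) →
                 ∀ t → g t < 3 ^ (q₀ + t) * c
  3^-dominates g q₀ c base step zero    = subst (λ q → g 0 < 3 ^ q * c) (sym (+-identityʳ q₀)) base
  3^-dominates g q₀ c base step (suc t) = begin-strict
    g (suc t)                 ≤⟨ step t ⟩
    3 * g t                   <⟨ *-monoʳ-< 3 (3^-dominates g q₀ c base step t) ⟩
    3 * (3 ^ (q₀ + t) * c)    ≡⟨ *-assoc 3 (3 ^ (q₀ + t)) c ⟨
    3 ^ suc (q₀ + t) * c      ≡⟨ cong (λ q → 3 ^ q * c) (+-suc q₀ t) ⟨
    3 ^ (q₀ + suc t) * c      ∎
    where open ≤-Reasoning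

  2+square-step : ∀ {N} → 4 ≤ N → 2 + (3 + N) * (3 + N) ≤ 3 * (2 + N * N)
  2+square-step (s≤s (s≤s (s≤s (s≤s {n = s} z≤n)))) =
    subst (2 + (7 + s) * (7 + s) ≤_) (sym (slack s)) (m≤m+n _ (3 + 10 * s + 2 * (s * s)))
    where
    slack : ∀ s → 3 * (2 + (4 + s) * (4 + s)) ≡ 2 + (7 + s) * (7 + s) + (3 + 10 * s + 2 * (s * s))
    slack = solve-∀

  ⌈_/3⌉-+* : ∀ r q → ⌈ r + q * 3 /3⌉ ≡ (r + 2) / 3 + q
  ⌈ r /3⌉-+* q = begin
    (r + q * 3 + 2) / 3       ≡⟨ /-congˡ (reorder r q) ⟩
    (r + 2 + q * 3) / 3       ≡⟨ +-distrib-/-∣ʳ (r + 2) (divides-refl q) ⟩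
    (r + 2) / 3 + q * 3 / 3   ≡⟨ cong ((r + 2) / 3 +_) (m*n/n≡m q 3) ⟩
    (r + 2) / 3 + q           ∎
    where
    open ≡-Reasoning
    reorder : ∀ r q → r + q * 3 + 2 ≡ r + 2 + q * 3
    reorder = solve-∀

  2+N²<3^ : ∀ r q₀ c → 2 + (15 + r) * (15 + r) < 3 ^ q₀ * c →
            ∀ t → 2 + (15 + (r + t * 3)) * (15 + (r + t * 3)) < 3 ^ (q₀ + t) * c
  2+N²<3^ r q₀ c base = 3^-dominates g q₀ c (subst (λ x → 2 + (15 + x) * (15 + x) < _) (sym (+-identityʳ r)) base) step
    where
    g : ℕ → ℕ
    g t = 2 + (15 + (r + t * 3)) * (15 + (r + t * 3))
    next : ∀ r t → 15 + (r + suc t * 3) ≡ 3 + (15 + (r + t * 3))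
    next = solve-∀
    step : ∀ t → g (suc t) ≤ 3 * g t
    step t = subst (λ N → 2 + N * N ≤ 3 * g t) (sym (next r t)) (2+square-step (m≤m+n 4 (11 + (r + t * 3))))

  Beats : ℕ → Set
  Beats n = ξac (S n) ℚ.< ξac (TB n ⌈ n ∸ 1 /3⌉)

  beats? : ∀ n → Dec (Beats n)
  beats? n = ξac (S n) ℚ.<? ξac (TB n ⌈ n ∸ 1 /3⌉)

  -- Leaving the implicit arguments of subst to unification makes Agda normalise ξac here.
  beats-if : ∀ {N k' a b} → ⌈ N /3⌉ ≡ suc k' → a + b ≡ suc k' → N ≡ suc k' + (suc k' + a) →
             2 + N * N < 3 ^ a * 2 ^ b → Beats (suc N)
  beats-if {N} {k'} ⌈N/3⌉≡k a+b≡k N≡2k+a N²<3ᵃ2ᵇ =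
    subst (λ k → ξac (S (suc N)) ℚ.< ξac (TB (suc N) k)) {suc k'} {⌈ N /3⌉} (sym ⌈N/3⌉≡k)
      (star<tb a+b≡k N≡2k+a N²<3ᵃ2ᵇ)

  ⌈15+r+3t/3⌉ : ∀ r t → ⌈ 15 + (r + t * 3) /3⌉ ≡ (r + 2) / 3 + (5 + t)
  ⌈15+r+3t/3⌉ r t = trans (cong ⌈_/3⌉ (shift r t)) (⌈ r /3⌉-+* (5 + t))
    where
    shift : ∀ r t → 15 + (r + t * 3) ≡ r + (5 + t) * 3
    shift = solve-∀

  beats-16+r+3t : ∀ r t → r < 3 → Beats (16 + (r + t * 3))
  beats-16+r+3t 0 t _ = beats-if {15 + (0 + t * 3)} {4 + t} {5 + t} {0}
    (⌈15+r+3t/3⌉ 0 t) (+-identityʳ (5 + t)) (shape t) (2+N²<3^ 0 5 1 (<ᵇ⇒< 227 243 _) t)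
    where
    shape : ∀ t → 15 + (0 + t * 3) ≡ (5 + t) + ((5 + t) + (5 + t))
    shape = solve-∀
  beats-16+r+3t 1 t _ = beats-if {15 + (1 + t * 3)} {5 + t} {4 + t} {2}
    (⌈15+r+3t/3⌉ 1 t) (+-comm (4 + t) 2) (shape t) (2+N²<3^ 1 4 4 (<ᵇ⇒< 258 324 _) t)
    where
    shape : ∀ t → 15 + (1 + t * 3) ≡ (6 + t) + ((6 + t) + (4 + t))
    shape = solve-∀
  beats-16+r+3t 2 t _ = beats-if {15 + (2 + t * 3)} {5 + t} {5 + t} {1}
    (⌈15+r+3t/3⌉ 2 t) (+-comm (5 + t) 1) (shape t) (2+N²<3^ 2 5 2 (<ᵇ⇒< 291 486 _) t)
    where
    shape : ∀ t → 15 + (2 + t * 3) ≡ (6 + t) + ((6 + t) + (5 + t))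
    shape = solve-∀
  beats-16+r+3t (suc (suc (suc _))) _ (s≤s (s≤s (s≤s ())))

  beats-from-16 : ∀ n → 16 ≤ n → Beats n
  beats-from-16 n 16≤n = subst Beats n≡16+r+3t (beats-16+r+3t (m % 3) (m / 3) (m%n<n m 3))
    where
    m = n ∸ 16
    n≡16+r+3t : 16 + (m % 3 + m / 3 * 3) ≡ n
    n≡16+r+3t = trans (cong (16 +_) (sym (m≡m%n+[m/n]*n m 3))) (m+[n∸m]≡n 16≤n)

  ¬beats-below-16 : All (λ n → 5 ≤ n → ¬ Beats n) (upTo 16)
  ¬beats-below-16 = from-yes (all? (λ n → 5 ≤? n →-dec ¬? (beats? n)) (upTo 16))

  beats⇒16≤n : ∀ n → 5 ≤ n → Beats n → 16 ≤ n
  beats⇒16≤n n 5≤n beats = decidable-stable (16 ≤? n) λ n≱16 →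
    lookup ¬beats-below-16 (∈-upTo⁺ (≰⇒> n≱16)) 5≤n beats

open import Data.Nat using (ℕ; _≤_; _∸_)
open import Data.Rational using (_<_)
open import Function.Bundles using (_⇔_; mk⇔)

lemma10 : (n : ℕ) → 5 ≤ n →
    ((ξac (S n) < ξac (TB n ⌈ n ∸ 1 /3⌉)) ⇔ (16 ≤ n))
lemma10 n 5≤n = mk⇔ (beats⇒16≤n n 5≤n) (beats-from-16 n)
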